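{- Let $p\ge 5$ be a prime with $p\equiv 2\pmod 3$. Then the congruence \[ \Lambda_p\bigl(C_{\mathrm{mix}}(q)H_{\mathrm{mix}}(q)^{pX}\bigr)\equiv C_{\mathrm{mix}}(q)H_{\mathrm{mix}}(q)^{X}\pmod{(p^4,X^4)} \] does not hold.
   Context: Let $q$ be a formal variable and $\chi_3$ the nontrivial Dirichlet character mod $3$. Put $u(q):=q\prod_{n\ge1}(1-q^{3n})^{12}/(1-q^n)^{12}$ (i.e. $\eta(3\tau)^{12}/\eta(\tau)^{12}$ with $q=e^{2\pi i\tau}$), $t(q):=u/(1+27u)^2$, and $H_{\mathrm{mix}}(q):=q/t(q)\in 1+q\mathbf{Z}[[q]]$. Let $E_{5,\chi_0,\chi_3}(q):=\tfrac13+\sum_{n\ge1}\bigl(\sum_{d\mid n}\chi_3(d)d^4\bigr)q^n$ and $E_{5,\chi_3,\chi_0}(q):=\sum_{n\ge1}\bigl(\sum_{d\mid n}\chi_3(n/d)d^4\bigr)q^n$, and $C_{\mathrm{mix}}:=3E_{5,\chi_0,\chi_3}-27E_{5,\chi_3,\chi_0}\in\mathbf{Z}[[q]]$. For a formal variable $X$, $H_{\mathrm{mix}}^X:=\exp(X\log H_{\mathrm{mix}})\in\mathbf{Q}[[q]][[X]]$. The Cartier operator $\Lambda_p\bigl(\sum a_nq^n\bigr)=\sum a_{pn}q^n$ acts coefficientwise in $X$. The congruence modulo $(p^4,X^4)$ means that for each $j=0,1,2,3$ the coefficients of $X^j$ on the two sides are congruent modulo $p^4\mathbf{Z}_{(p)}[[q]]$.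 -}

module Defs where

open import Data.Nat as ℕ using (ℕ; zero; suc; _∸_; _≤_; _<_; NonZero)
open import Data.Nat.Properties using (_!≢0)
open import Data.Nat.Divisibility using (_∣_; _∣?_)
open import Data.Integer as ℤ using (ℤ; +_; -[1+_])
open import Data.Rational as ℚ using (ℚ; 0ℚ; 1ℚ; _+_; _*_; -_; _-_)
open import Data.List using (List; []; _∷_)
open import Data.Product using (∃; _×_)
open import Relation.Nullary using (¬_; yes; no)
open import Relation.Binary.PropositionalEquality using (_≡_)

-- Formal power series in q with rational coefficients:
-- a series is its coefficient function  n ↦ [q^n] f.

Series : Set
Series = ℕ → ℚ

ℕ→ℚ : ℕ → ℚ
ℕ→ℚ n = (+ n) ℚ./ 1

ℤ→ℚ : ℤ → ℚ
ℤ→ℚ z = z ℚ./ 1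

sumTo : ℕ → (ℕ → ℚ) → ℚ
sumTo zero    f = f 0
sumTo (suc n) f = sumTo n f + f (suc n)

sum1To : ℕ → (ℕ → ℚ) → ℚ
sum1To zero    f = 0ℚ
sum1To (suc n) f = sum1To n f + f (suc n)

constS : ℚ → Series
constS c zero    = c
constS c (suc n) = 0ℚ

oneS : Series
oneS = constS 1ℚ

qPow : ℕ → Series
qPow k n with k ℕ.≟ n
... | yes _ = 1ℚ
... | no  _ = 0ℚ

_⊕_ : Series → Series → Series
(f ⊕ g) n = f n + g n

_⊖_ : Series → Series → Series
(f ⊖ g) n = f n - g n

_•_ : ℚ → Series → Series
(c • f) n = c * f n

_⊛_ : Series → Series → Series
(f ⊛ g) n = sumTo n (λ i → f i * g (n ∸ i))

infixl 6 _⊕_ _⊖_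
infixl 7 _⊛_ _•_

powS : Series → ℕ → Series
powS f zero    = oneS
powS f (suc k) = f ⊛ powS f k

-- multiplication by q and division by q (the latter used only on
-- series with zero constant term)
divQ : Series → Series
divQ f n = f (suc n)

-- Multiplicative inverse of a series with constant term 1:
-- g_0 = 1,  g_n = - Σ_{i=1}^{n} f_i g_{n-i}.
-- invList f n = [g_n , g_{n-1} , … , g_0].
private
  invStep : Series → ℕ → List ℚ → ℚ
  invStep f k []       = 0ℚ
  invStep f k (g ∷ gs) = f (suc k) * g + invStep f (suc k) gs

invList : Series → ℕ → List ℚ
invList f zero    = 1ℚ ∷ []
invList f (suc n) = (- invStep f 0 (invList f n)) ∷ invList f n

headOr0 : List ℚ → ℚ
headOr0 []      = 0ℚ
headOr0 (x ∷ _) = x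

invS : Series → Series
invS f n = headOr0 (invList f n)

-- Infinite product  ∏_{m ≥ 1} (1 - q^{a m})  (a ≥ 1): its coefficient of
-- q^N equals that of the finite product ∏_{m=1}^{N} (1 - q^{a m}).
prodTo : ℕ → ℕ → Series
prodTo a zero    = oneS
prodTo a (suc m) = prodTo a m ⊛ (oneS ⊖ qPow (a ℕ.* suc m))

infProd : ℕ → Series
infProd a N = prodTo a N N

uS : Series
uS = qPow 1 ⊛ (powS (infProd 3) 12 ⊛ invS (powS (infProd 1) 12))

tS : Series
tS = uS ⊛ invS (powS (oneS ⊕ ℕ→ℚ 27 • uS) 2)

-- H_mix(q) = q / t(q)   (t = q·(1 + …), so q/t = 1/(t/q))
Hmix : Series
Hmix = invS (divQ tS)

χ₃ : ℕ → ℤ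
χ₃ n with n ℕ.% 3
... | 1 = + 1
... | 2 = -[1+ 0 ]
... | _ = + 0

divisorSum : ℕ → (ℕ → ℕ → ℚ) → ℚ
divisorSum n f = sum1To n term
  where
  term : ℕ → ℚ
  term zero = 0ℚ
  term (suc e) with suc e ∣? n
  ... | yes _ = f (suc e) (n ℕ./ suc e)
  ... | no  _ = 0ℚ

E5χ0χ3 : Series
E5χ0χ3 zero    = (+ 1) ℚ./ 3
E5χ0χ3 (suc n) = divisorSum (suc n) (λ d e → ℤ→ℚ (χ₃ d) * ℕ→ℚ (d ℕ.^ 4))

E5χ3χ0 : Series
E5χ3χ0 zero    = 0ℚ
E5χ3χ0 (suc n) = divisorSum (suc n) (λ d e → ℤ→ℚ (χ₃ e) * ℕ→ℚ (d ℕ.^ 4))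

Cmix : Series
Cmix = ℕ→ℚ 3 • E5χ0χ3 ⊖ ℕ→ℚ 27 • E5χ3χ0

-- log H = Σ_{k≥1} (-1)^{k+1} (H-1)^k / k   for H with constant term 1;
-- only k ≤ n contributes to the coefficient of q^n.
logS : Series → Series
logS H n = sum1To n term
  where
  term : ℕ → ℚ
  term zero    = 0ℚ
  term (suc i) = (sgn i ℚ./ suc i) * powS (H ⊖ oneS) (suc i) n
    where
    sgn : ℕ → ℤ
    sgn i with i ℕ.% 2
    ... | 0 = + 1
    ... | _ = -[1+ 0 ]

-- Elements of Q[[q]][[X]], given by j ↦ (coefficient series of X^j).
XSeries : Set
XSeries = ℕ → Series

-- exp(X F) for F ∈ q Q[[q]]: coefficient of X^j is F^j / j!
expX : Series → XSeries
expX F j n = powS F j n * invFact j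
  where
  invFact : ℕ → ℚ
  invFact j = ℚ._/_ (+ 1) (j ℕ.!) {{j !≢0}}

-- H^{cX} := exp(c X log H)
powX : Series → ℚ → XSeries
powX H c = expX (c • logS H)

_⊛X_ : Series → XSeries → XSeries
(C ⊛X F) j = C ⊛ F j

Λ : ℕ → Series → Series
Λ p f n = f (p ℕ.* n)

ΛX : ℕ → XSeries → XSeries
ΛX p F j = Λ p (F j)

-- r ∈ p^k Z_(p) :  r = p^k a / b  with a ∈ ℤ, b ≥ 1, p ∤ b
InPowZp : ℕ → ℕ → ℚ → Set
InPowZp p k r = ∃ λ (a : ℤ) → ∃ λ (b : ℕ) →
  (¬ (p ∣ suc b)) × (r ≡ ((+ (p ℕ.^ k)) ℤ.* a) ℚ./ suc b)

-- F ≡ G mod (p^k, X^m): for each j < m, the X^j-coefficients are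
-- congruent modulo p^k Z_(p)[[q]]
CongPX : ℕ → ℕ → ℕ → XSeries → XSeries → Set
CongPX p k m F G = ∀ j → j < m → ∀ n → InPowZp p k (F j n - G j n)

{-# OPTIONS --safe #-}
-- Already the X⁰-coefficients refute the congruence: there it reads Λ_p C_mix ≡ C_mix, and at q¹
-- it compares C_mix(p) with C_mix(1) = -24.  For a prime p ≡ 2 (mod 3) the divisor sums have only
-- the terms d = 1 and d = p, so C_mix(p) = 3(1 - p⁴) - 27(p⁴ - 1) = 30 - 30p⁴, and the difference
-- 54 - 30p⁴ is not even divisible by p, since 54 = 2·3³ and p ≥ 5.
module Submission where

open import Defs
open import Function using (_∘_; id)
open import Data.Nat as ℕ using (ℕ; zero; suc; _≤_; _%_; _∸_; _^_; z≤n; s≤s)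
import Data.Nat.Properties as ℕP
open import Data.Nat.DivMod using (n/1≡n; n/n≡1)
open import Data.Nat.Divisibility using (_∣_; _∣?_; ∣⇒≤; ∣1⇒≡1; 1∣_; ∣-refl; m∣m*n; ∣m⇒∣m*n)
open import Data.Nat.Primality
  using (Prime; euclidsLemma; ¬prime[0]; ¬prime[1]; prime⇒¬composite; composite)
open import Data.Integer as ℤ using (ℤ; +_; -[1+_])
import Data.Integer.Properties as ℤP
import Data.Integer.Divisibility.Signed as ℤDiv
open import Data.Rational as ℚ using (ℚ; 0ℚ; 1ℚ; _+_; _*_; -_; _-_)
import Data.Rational.Properties as ℚP
open import Data.Rational.Unnormalised as ℚᵘ using (mkℚᵘ; *≡*; _≃_)
import Data.Rational.Unnormalised.Properties as ℚᵘP
open import Data.Rational.Solver using (module +-*-Solver)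
open import Data.Product using (_,_)
open import Data.Sum using ([_,_]′)
open import Relation.Nullary using (¬_; yes; no; contradiction)
open import Relation.Binary.PropositionalEquality

sumTo-cong : ∀ n {f g : ℕ → ℚ} → (∀ {i} → i ≤ n → f i ≡ g i) → sumTo n f ≡ sumTo n g
sumTo-cong zero    f≗g = f≗g z≤n
sumTo-cong (suc n) f≗g = cong₂ _+_ (sumTo-cong n (f≗g ∘ ℕP.m≤n⇒m≤1+n)) (f≗g ℕP.≤-refl)

sumTo-zero : ∀ n → sumTo n (λ _ → 0ℚ) ≡ 0ℚ
sumTo-zero zero    = refl
sumTo-zero (suc n) = cong (_+ 0ℚ) (sumTo-zero n)

⊛-congʳ : ∀ f {g h : Series} → (∀ n → g n ≡ h n) → ∀ n → (f ⊛ g) n ≡ (f ⊛ h) n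
⊛-congʳ f g≗h n = sumTo-cong n (λ {i} _ → cong (f i *_) (g≗h (n ∸ i)))

⊛-identityʳ : ∀ f n → (f ⊛ oneS) n ≡ f n
⊛-identityʳ f zero    = ℚP.*-identityʳ (f 0)
⊛-identityʳ f (suc n) = begin
  (f ⊛ oneS) (suc n)                                    ≡⟨ cong₂ _+_ lower top ⟩
  0ℚ + f (suc n)                                        ≡⟨ ℚP.+-identityˡ (f (suc n)) ⟩
  f (suc n)                                             ∎
  where
  open ≡-Reasoning
  lower : sumTo n (λ i → f i * oneS (suc n ∸ i)) ≡ 0ℚ
  lower = trans (sumTo-cong n vanish) (sumTo-zero n)
    where
    vanish : ∀ {i} → i ≤ n → f i * oneS (suc n ∸ i) ≡ 0ℚ
    vanish {i} i≤n = trans (cong (λ k → f i * oneS k) (ℕP.+-∸-assoc 1 i≤n)) (ℚP.*-zeroʳ (f i))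
  top : f (suc n) * oneS (n ∸ n) ≡ f (suc n)
  top = trans (cong (λ k → f (suc n) * oneS k) (ℕP.n∸n≡0 n)) (ℚP.*-identityʳ (f (suc n)))

expX-zero : ∀ F n → expX F 0 n ≡ oneS n
expX-zero F n = ℚP.*-identityʳ (oneS n)

⊛X-powX-zero : ∀ C H c n → (C ⊛X powX H c) 0 n ≡ C n
⊛X-powX-zero C H c n = trans (⊛-congʳ C (expX-zero (c • logS H)) n) (⊛-identityʳ C n)

sum1To-cong : ∀ n {t u : ℕ → ℚ} → (∀ i → t i ≡ u i) → sum1To n t ≡ sum1To n u
sum1To-cong zero    t≗u = refl
sum1To-cong (suc n) t≗u = cong₂ _+_ (sum1To-cong n t≗u) (t≗u (suc n))

sum1To-supported-at-1 : ∀ n (t : ℕ → ℚ) → (∀ {i} → 2 ≤ i → i ≤ suc n → t i ≡ 0ℚ) →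
  sum1To (suc n) t ≡ t 1
sum1To-supported-at-1 zero    t t≡0 = ℚP.+-identityˡ (t 1)
sum1To-supported-at-1 (suc n) t t≡0 = begin
  sum1To (suc n) t + t (2 ℕ.+ n) ≡⟨ cong₂ _+_ (sum1To-supported-at-1 n t (λ 2≤i → t≡0 2≤i ∘ ℕP.m≤n⇒m≤1+n))
                                              (t≡0 (s≤s (s≤s z≤n)) ℕP.≤-refl) ⟩
  t 1 + 0ℚ                       ≡⟨ ℚP.+-identityʳ (t 1) ⟩
  t 1                            ∎
  where open ≡-Reasoning

-- A copy of the summand of divisorSum, which Defs keeps local.
divisorTerm : ℕ → (ℕ → ℕ → ℚ) → ℕ → ℚ
divisorTerm n f zero = 0ℚ
divisorTerm n f (suc e) with suc e ∣? n
... | yes _ = f (suc e) (n ℕ./ suc e)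
... | no  _ = 0ℚ

-- The mutual block lets unification fill in the local summand for the `_`.
mutual
  divisorSum-divisorTerm : ∀ n f → divisorSum n f ≡ sum1To n (divisorTerm n f)
  divisorSum-divisorTerm n f = sum1To-cong n (divisorSum-summand n f)

  divisorSum-summand : ∀ n f e → _ ≡ divisorTerm n f e
  divisorSum-summand n f zero = refl
  divisorSum-summand n f (suc e) with suc e ∣? n
  ... | yes _ = refl
  ... | no  _ = refl

divisorTerm-1 : ∀ n f → divisorTerm n f 1 ≡ f 1 n
divisorTerm-1 n f with 1 ∣? n
... | yes _   = cong (f 1) (n/1≡n n)
... | no  1∤n = contradiction (1∣ n) 1∤n

divisorTerm-self : ∀ m f → divisorTerm (suc m) f (suc m) ≡ f (suc m) 1
divisorTerm-self m f with suc m ∣? suc m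
... | yes _ = cong (f (suc m)) (n/n≡1 (suc m))
... | no  ∤ = contradiction ∣-refl ∤

divisorTerm-∤ : ∀ {n} f d → ¬ d ∣ n → divisorTerm n f d ≡ 0ℚ
divisorTerm-∤     f zero    d∤n = refl
divisorTerm-∤ {n} f (suc e) d∤n with suc e ∣? n
... | yes d∣n = contradiction d∣n d∤n
... | no  _   = refl

divisorSum-prime : ∀ {p} f → Prime p → divisorSum p f ≡ f 1 p + f p 1
divisorSum-prime {0}           f pr = contradiction pr ¬prime[0]
divisorSum-prime {1}           f pr = contradiction pr ¬prime[1]
divisorSum-prime {suc (suc m)} f pr = begin
  divisorSum p f                                        ≡⟨ divisorSum-divisorTerm p f ⟩
  sum1To (suc m) (divisorTerm p f) + divisorTerm p f p  ≡⟨ cong₂ _+_ interior (divisorTerm-self (suc m) f) ⟩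
  f 1 p + f p 1                                         ∎
  where
  open ≡-Reasoning
  p = suc (suc m)
  nondivisor : ∀ {d} → 2 ≤ d → d ≤ suc m → ¬ d ∣ p
  nondivisor (s≤s (s≤s _)) d≤1+m d∣p = prime⇒¬composite pr (composite (s≤s d≤1+m) d∣p)
  interior : sum1To (suc m) (divisorTerm p f) ≡ f 1 p
  interior = trans (sum1To-supported-at-1 m (divisorTerm p f)
                     (λ 2≤d d≤1+m → divisorTerm-∤ f _ (nondivisor 2≤d d≤1+m)))
                   (divisorTerm-1 p f)

χ₃-2mod3 : ∀ {p} → p % 3 ≡ 2 → χ₃ p ≡ -[1+ 0 ]
χ₃-2mod3 p≡2 rewrite p≡2 = refl

E5χ0χ3-prime : ∀ {p} → Prime p → E5χ0χ3 p ≡ 1ℚ + ℤ→ℚ (χ₃ p) * ℕ→ℚ (p ^ 4)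
E5χ0χ3-prime {zero}  pr = contradiction pr ¬prime[0]
E5χ0χ3-prime {suc n} pr = divisorSum-prime _ pr

E5χ3χ0-prime : ∀ {p} → Prime p → E5χ3χ0 p ≡ ℤ→ℚ (χ₃ p) + ℕ→ℚ (p ^ 4)
E5χ3χ0-prime {zero}  pr = contradiction pr ¬prime[0]
E5χ3χ0-prime {suc n} pr =
  trans (divisorSum-prime _ pr)
        (cong₂ _+_ (ℚP.*-identityʳ (ℤ→ℚ (χ₃ (suc n)))) (ℚP.*-identityˡ (ℕ→ℚ (suc n ^ 4))))

Cmix-prime : ∀ {p} → Prime p → p % 3 ≡ 2 → Cmix p ≡ ℕ→ℚ 30 - ℕ→ℚ 30 * ℕ→ℚ (p ^ 4)
Cmix-prime {p} pr p≡2 = begin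
  ℕ→ℚ 3 * E5χ0χ3 p - ℕ→ℚ 27 * E5χ3χ0 p
    ≡⟨ cong₂ (λ x y → ℕ→ℚ 3 * x - ℕ→ℚ 27 * y) (E5χ0χ3-prime pr) (E5χ3χ0-prime pr) ⟩
  ℕ→ℚ 3 * (1ℚ + ℤ→ℚ (χ₃ p) * P) - ℕ→ℚ 27 * (ℤ→ℚ (χ₃ p) + P)
    ≡⟨ cong (λ χ → ℕ→ℚ 3 * (1ℚ + ℤ→ℚ χ * P) - ℕ→ℚ 27 * (ℤ→ℚ χ + P)) (χ₃-2mod3 {p} p≡2) ⟩
  ℕ→ℚ 3 * (1ℚ + ℤ→ℚ -[1+ 0 ] * P) - ℕ→ℚ 27 * (ℤ→ℚ -[1+ 0 ] + P)
    ≡⟨ solve 1 (λ P → con (ℕ→ℚ 3) :* (con 1ℚ :+ con (ℤ→ℚ -[1+ 0 ]) :* P)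
                        :- con (ℕ→ℚ 27) :* (con (ℤ→ℚ -[1+ 0 ]) :+ P)
                      := con (ℕ→ℚ 30) :- con (ℕ→ℚ 30) :* P) refl P ⟩
  ℕ→ℚ 30 - ℕ→ℚ 30 * P ∎
  where
  open ≡-Reasoning
  open +-*-Solver
  P = ℕ→ℚ (p ^ 4)

toℚᵘ-ℤ→ℚ : ∀ z → ℚ.toℚᵘ (ℤ→ℚ z) ≃ mkℚᵘ z 0
toℚᵘ-ℤ→ℚ z = ℚP.toℚᵘ-fromℚᵘ (mkℚᵘ z 0)

ℤ→ℚ-homo-+ : ∀ i j → ℤ→ℚ (i ℤ.+ j) ≡ ℤ→ℚ i + ℤ→ℚ j
ℤ→ℚ-homo-+ i j = ℚP.toℚᵘ-injective (begin
  ℚ.toℚᵘ (ℤ→ℚ (i ℤ.+ j))                  ≈⟨ toℚᵘ-ℤ→ℚ (i ℤ.+ j) ⟩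
  mkℚᵘ (i ℤ.+ j) 0
    ≈⟨ *≡* (cong (ℤ._* + 1) (sym (cong₂ ℤ._+_ (ℤP.*-identityʳ i) (ℤP.*-identityʳ j)))) ⟩
  mkℚᵘ i 0 ℚᵘ.+ mkℚᵘ j 0                   ≈⟨ ℚᵘP.+-cong (toℚᵘ-ℤ→ℚ i) (toℚᵘ-ℤ→ℚ j) ⟨
  ℚ.toℚᵘ (ℤ→ℚ i) ℚᵘ.+ ℚ.toℚᵘ (ℤ→ℚ j)      ≈⟨ ℚP.toℚᵘ-homo-+ (ℤ→ℚ i) (ℤ→ℚ j) ⟨
  ℚ.toℚᵘ (ℤ→ℚ i + ℤ→ℚ j)                  ∎)
  where open ℚᵘP.≃-Reasoning

ℤ→ℚ-homo-* : ∀ i j → ℤ→ℚ (i ℤ.* j) ≡ ℤ→ℚ i * ℤ→ℚ j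
ℤ→ℚ-homo-* i j = ℚP.toℚᵘ-injective (begin
  ℚ.toℚᵘ (ℤ→ℚ (i ℤ.* j))                  ≈⟨ toℚᵘ-ℤ→ℚ (i ℤ.* j) ⟩
  mkℚᵘ i 0 ℚᵘ.* mkℚᵘ j 0                   ≈⟨ ℚᵘP.*-cong (toℚᵘ-ℤ→ℚ i) (toℚᵘ-ℤ→ℚ j) ⟨
  ℚ.toℚᵘ (ℤ→ℚ i) ℚᵘ.* ℚ.toℚᵘ (ℤ→ℚ j)      ≈⟨ ℚP.toℚᵘ-homo-* (ℤ→ℚ i) (ℤ→ℚ j) ⟨
  ℚ.toℚᵘ (ℤ→ℚ i * ℤ→ℚ j)                  ∎)
  where open ℚᵘP.≃-Reasoning

ℤ→ℚ-homo‿- : ∀ i → ℤ→ℚ (ℤ.- i) ≡ - ℤ→ℚ i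
ℤ→ℚ-homo‿- i = ℚP.toℚᵘ-injective (begin
  ℚ.toℚᵘ (ℤ→ℚ (ℤ.- i))                    ≈⟨ toℚᵘ-ℤ→ℚ (ℤ.- i) ⟩
  ℚᵘ.- mkℚᵘ i 0                            ≈⟨ ℚᵘP.-‿cong (toℚᵘ-ℤ→ℚ i) ⟨
  ℚᵘ.- ℚ.toℚᵘ (ℤ→ℚ i)                      ≈⟨ ℚP.toℚᵘ-homo‿- (ℤ→ℚ i) ⟨
  ℚ.toℚᵘ (- ℤ→ℚ i)                         ∎)
  where open ℚᵘP.≃-Reasoning

InPowZp-ℤ⇒∣ : ∀ {p k} z → Prime p → InPowZp p (suc k) (ℤ→ℚ z) → p ∣ ℤ.∣ z ∣
InPowZp-ℤ⇒∣ {p} {k} z pr (a , b , p∤b , z≡) =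
  [ id , (λ p∣b → contradiction p∣b p∤b) ]′ (euclidsLemma ℤ.∣ z ∣ (suc b) pr p∣z*b)
  where
  open ≡-Reasoning
  cross : z ℤ.* + suc b ≡ (+ (p ^ suc k) ℤ.* a) ℤ.* + 1
  cross = ℚᵘP.drop-*≡* (ℚP.fromℚᵘ-injective {mkℚᵘ z 0} {mkℚᵘ (+ (p ^ suc k) ℤ.* a) b} z≡)
  ∣cross∣ : ℤ.∣ z ∣ ℕ.* suc b ≡ p ^ suc k ℕ.* ℤ.∣ a ∣
  ∣cross∣ = begin
    ℤ.∣ z ∣ ℕ.* suc b                ≡⟨ ℤP.abs-* z (+ suc b) ⟨
    ℤ.∣ z ℤ.* + suc b ∣              ≡⟨ cong ℤ.∣_∣ (trans cross (ℤP.*-identityʳ (+ (p ^ suc k) ℤ.* a))) ⟩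
    ℤ.∣ + (p ^ suc k) ℤ.* a ∣        ≡⟨ ℤP.abs-* (+ (p ^ suc k)) a ⟩
    p ^ suc k ℕ.* ℤ.∣ a ∣            ∎
  p∣z*b : p ∣ ℤ.∣ z ∣ ℕ.* suc b
  p∣z*b = subst (p ∣_) (sym ∣cross∣) (∣m⇒∣m*n ℤ.∣ a ∣ (m∣m*n (p ^ k)))

∣m-c*p^[1+k]⇒∣m : ∀ {p} m c k → p ∣ ℤ.∣ + m ℤ.- + c ℤ.* + (p ^ suc k) ∣ → p ∣ m
∣m-c*p^[1+k]⇒∣m {p} m c k p∣ =
  ℤDiv.∣⇒∣ᵤ (ℤDiv.∣m+n∣n⇒∣m {m = + m} (ℤDiv.∣ᵤ⇒∣ p∣)
                                       (ℤDiv.∣m⇒∣-m (ℤDiv.∣n⇒∣m*n (+ c) p∣p^[1+k])))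
  where
  p∣p^[1+k] : + p ℤDiv.∣ + (p ^ suc k)
  p∣p^[1+k] = ℤDiv.∣ᵤ⇒∣ (m∣m*n (p ^ k))

prime∣^⇒∣ : ∀ {p m} n → Prime p → p ∣ m ^ n → p ∣ m
prime∣^⇒∣ zero    pr p∣1 = contradiction (subst Prime (∣1⇒≡1 p∣1) pr) ¬prime[1]
prime∣^⇒∣ {m = m} (suc n) pr p∣m^[1+n] =
  [ id , prime∣^⇒∣ n pr ]′ (euclidsLemma m (m ^ n) pr p∣m^[1+n])

prime∣2*3³⇒≤3 : ∀ {p} → Prime p → p ∣ 2 ℕ.* 3 ^ 3 → p ≤ 3
prime∣2*3³⇒≤3 pr p∣54 =
  [ (λ p∣2 → ℕP.m≤n⇒m≤1+n (∣⇒≤ p∣2)) , (λ p∣3³ → ∣⇒≤ (prime∣^⇒∣ 3 pr p∣3³)) ]′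
    (euclidsLemma 2 (3 ^ 3) pr p∣54)

Cmix[p]-Cmix[1] : ∀ {p} → Prime p → p % 3 ≡ 2 → Cmix p - Cmix 1 ≡ ℤ→ℚ (+ 54 ℤ.- + 30 ℤ.* + (p ^ 4))
Cmix[p]-Cmix[1] {p} pr p≡2 = begin
  Cmix p - Cmix 1                            ≡⟨ cong (_- Cmix 1) (Cmix-prime pr p≡2) ⟩
  ℕ→ℚ 30 - ℕ→ℚ 30 * P - Cmix 1
    ≡⟨ solve 1 (λ P → con (ℕ→ℚ 30) :- con (ℕ→ℚ 30) :* P :- con (ℤ→ℚ -[1+ 23 ])
                    := con (ℕ→ℚ 54) :- con (ℕ→ℚ 30) :* P) refl P ⟩
  ℕ→ℚ 54 - ℕ→ℚ 30 * P
    ≡⟨ cong (λ x → ℕ→ℚ 54 + x) (trans (ℤ→ℚ-homo‿- (+ 30 ℤ.* + (p ^ 4)))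
                                       (cong -_ (ℤ→ℚ-homo-* (+ 30) (+ (p ^ 4))))) ⟨
  ℕ→ℚ 54 + ℤ→ℚ (ℤ.- (+ 30 ℤ.* + (p ^ 4)))    ≡⟨ ℤ→ℚ-homo-+ (+ 54) (ℤ.- (+ 30 ℤ.* + (p ^ 4))) ⟨
  ℤ→ℚ (+ 54 ℤ.- + 30 ℤ.* + (p ^ 4))          ∎
  where
  open ≡-Reasoning
  open +-*-Solver
  P = ℕ→ℚ (p ^ 4)

proposition5p3 : (p : ℕ) → Prime p → 5 ≤ p → p % 3 ≡ 2 →
    ¬ CongPX p 4 4 (ΛX p (Cmix ⊛X powX Hmix (ℕ→ℚ p))) (Cmix ⊛X powX Hmix (ℕ→ℚ 1))
proposition5p3 p pr 5≤p p≡2 congruence = contradiction (ℕP.≤-trans 5≤p p≤3) λ { (s≤s (s≤s (s≤s ()))) }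
  where
  z = + 54 ℤ.- + 30 ℤ.* + (p ^ 4)
  X⁰q¹-difference : ΛX p (Cmix ⊛X powX Hmix (ℕ→ℚ p)) 0 1 - (Cmix ⊛X powX Hmix (ℕ→ℚ 1)) 0 1 ≡ ℤ→ℚ z
  X⁰q¹-difference =
    trans (cong₂ _-_ (trans (⊛X-powX-zero Cmix Hmix (ℕ→ℚ p) (p ℕ.* 1)) (cong Cmix (ℕP.*-identityʳ p)))
                     (⊛X-powX-zero Cmix Hmix (ℕ→ℚ 1) 1))
          (Cmix[p]-Cmix[1] pr p≡2)
  p∣z : p ∣ ℤ.∣ z ∣
  p∣z = InPowZp-ℤ⇒∣ {k = 3} z pr (subst (InPowZp p 4) X⁰q¹-difference (congruence 0 (s≤s z≤n) 1))
  p≤3 : p ≤ 3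
  p≤3 = prime∣2*3³⇒≤3 pr (∣m-c*p^[1+k]⇒∣m 54 30 3 p∣z)
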